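{- Let $P,Q$ be $\mathbb{CCSP}_t$ processes that are both $\tau$-stable. If $P\simeq_{br}Q$ then $P\simeq_{rbr}Q$.
   Context: $\mathbb{CCSP}_t$ processes form an LTS $(\mathbb P,Act,\rightarrow)$ with $Act=A\uplus\{\tau,t\}$ ($A$ visible actions, $\tau$ hidden, $t$ time-out), given by the standard structural operational semantics of the process algebra (prefix, choice, parallel composition, abstraction, renaming, recursion, and environment operators $\theta_L^U$, $\psi_X$); the result only uses the LTS structure. $A_\tau:=A\cup\{\tau\}$. $P\xrightarrow{(\alpha)}P'$ means ($\alpha=\tau$ and $P=P'$) or $P\xrightarrow{\alpha}P'$; $\Longrightarrow$ is the reflexive-transitive closure of $\xrightarrow{\tau}$; $P\not\xrightarrow{\tau}$ means no $\tau$-transition; $\mathcal I(P):=\{\alpha\in A_\tau\mid\exists Q.\,P\xrightarrow{\alpha}Q\}$. A concrete branching reactive bisimulation is a symmetric ($\mathcal R(P,Q)\Leftrightarrow\mathcal R(Q,P)$, $\mathcal R(P,X,Q)\Leftrightarrow\mathcal R(Q,X,P)$) relation $\mathcal R\subseteq(\mathbb P\times\mathbb P)\cup(\mathbb P\times\mathcal P(A)\times\mathbb P)$ such that: 1. if $\mathcal R(P,Q)$: (a) if $P\xrightarrow{\alpha}P'$, $\alpha\in A_\tau$, there is $Q\Longrightarrow Q_1\xrightarrow{(\alpha)}Q_2$ with $\mathcal R(P,Q_1)$, $\mathcal R(P',Q_2)$; (b) $\mathcal R(P,Y,Q)$ for all $Y\subseteq A$; 2. if $\mathcal R(P,X,Q)$: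 (a) if $P\xrightarrow{\tau}P'$ there is $Q\Longrightarrow Q_1\xrightarrow{(\tau)}Q_2$ with $\mathcal R(P,X,Q_1)$, $\mathcal R(P',X,Q_2)$; (b) if $P\xrightarrow{a}P'$, $a\in X$, there is $Q\Longrightarrow Q_1\xrightarrow{a}Q_2$ with $\mathcal R(P,X,Q_1)$, $\mathcal R(P',Q_2)$; (c) if $\mathcal I(P)\cap(X\cup\{\tau\})=\emptyset$ there is $Q\Longrightarrow Q_0$ with $\mathcal R(P,Q_0)$; (d) if $\mathcal I(P)\cap(X\cup\{\tau\})=\emptyset$ and $P\xrightarrow{t}P'$ there is $Q\Longrightarrow Q_1\xrightarrow{t}Q_2$ with $\mathcal R(P',X,Q_2)$; (e) if $P\not\xrightarrow{\tau}$ there is $Q\Longrightarrow Q_0\not\xrightarrow{\tau}$. $P\simeq_{br}Q$ / $P\simeq^X_{br}Q$ iff $\mathcal R(P,Q)$ / $\mathcal R(P,X,Q)$ for some such $\mathcal R$. $P\simeq_{rbr}Q$ iff $\mathcal R(P,Q)$ for some symmetric relation $\mathcal R$ of the same type with: 1. if $\mathcal R(P,Q)$: (a) if $P\xrightarrow{\alpha}P'$, $\alpha\in A_\tau$, then $Q\xrightarrow{\alpha}Q'$ with $P'\simeq_{br}Q'$; (b) $\mathcal R(P,Y,Q)$ for all $Y$; 2. if $\mathcal R(P,X,Q)$: (a) if $P\xrightarrow{\tau}P'$ then $Q\xrightarrow{\tau}Q'$ with $P'\simeq^X_{br}Q'$; (b) if $P\xrightarrow{a}P'$, $a\in X$, then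 $Q\xrightarrow{a}Q'$ with $P'\simeq_{br}Q'$; (c) if $\mathcal I(P)\cap(X\cup\{\tau\})=\emptyset$ then $\mathcal R(P,Q)$; (d) if moreover $P\xrightarrow{t}P'$ then $Q\xrightarrow{t}Q'$ with $P'\simeq^X_{br}Q'$. A process $P$ is $\tau$-stable if for every transition $P\xrightarrow{\tau}P^\dagger$ we have $P\not\simeq_{br}P^\dagger$. -}

module Defs where

open import Data.Product using (Σ; ∃; ∃-syntax; _×_; _,_)
open import Data.Sum using (_⊎_)
open import Relation.Nullary using (¬_)
open import Relation.Binary.PropositionalEquality using (_≡_; _≢_)
open import Relation.Binary.Construct.Closure.ReflexiveTransitive using (Star)

data Act (A : Set) : Set where
  vis : A → Act A
  τ   : Act A
  t   : Act A

record LTS : Set₁ where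
  field
    Proc  : Set
    A     : Set
    _—[_]→_ : Proc → Act A → Proc → Set

module _ (L : LTS) where
  open LTS L

  Subset : Set₁
  Subset = A → Set

  InAτ : Act A → Set
  InAτ α = α ≢ t

  _—⟨_⟩→_ : Proc → Act A → Proc → Set
  P —⟨ α ⟩→ P' = (α ≡ τ × P ≡ P') ⊎ (P —[ α ]→ P')

  τstep : Proc → Proc → Set
  τstep P P' = P —[ τ ]→ P'

  _⟹_ : Proc → Proc → Set
  _⟹_ = Star τstep

  NoTau : Proc → Set
  NoTau P = ¬ (∃[ P' ] (P —[ τ ]→ P'))

  Idle : Proc → Subset → Set
  Idle P X = NoTau P × (∀ a → X a → ¬ (∃[ P' ] (P —[ vis a ]→ P')))

  record IsBrBisim (R₂ : Proc → Proc → Set) (R₃ : Proc → Subset → Proc → Set) : Set₁ where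
    field
      sym₂ : ∀ {P Q} → R₂ P Q → R₂ Q P
      sym₃ : ∀ {P X Q} → R₃ P X Q → R₃ Q X P
      c1a : ∀ {P Q α P'} → R₂ P Q → InAτ α → P —[ α ]→ P' →
            ∃[ Q₁ ] ∃[ Q₂ ] (Q ⟹ Q₁ × Q₁ —⟨ α ⟩→ Q₂ × R₂ P Q₁ × R₂ P' Q₂)
      c1b : ∀ {P Q} → R₂ P Q → ∀ (Y : Subset) → R₃ P Y Q
      c2a : ∀ {P X Q P'} → R₃ P X Q → P —[ τ ]→ P' →
            ∃[ Q₁ ] ∃[ Q₂ ] (Q ⟹ Q₁ × Q₁ —⟨ τ ⟩→ Q₂ × R₃ P X Q₁ × R₃ P' X Q₂)
      c2b : ∀ {P X Q P'} {a : A} → R₃ P X Q → X a → P —[ vis a ]→ P' →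
            ∃[ Q₁ ] ∃[ Q₂ ] (Q ⟹ Q₁ × Q₁ —[ vis a ]→ Q₂ × R₃ P X Q₁ × R₂ P' Q₂)
      c2c : ∀ {P X Q} → R₃ P X Q → Idle P X →
            ∃[ Q₀ ] (Q ⟹ Q₀ × R₂ P Q₀)
      c2d : ∀ {P X Q P'} → R₃ P X Q → Idle P X → P —[ t ]→ P' →
            ∃[ Q₁ ] ∃[ Q₂ ] (Q ⟹ Q₁ × Q₁ —[ t ]→ Q₂ × R₃ P' X Q₂)
      c2e : ∀ {P X Q} → R₃ P X Q → NoTau P →
            ∃[ Q₀ ] (Q ⟹ Q₀ × NoTau Q₀)

  _≃br_ : Proc → Proc → Set₁
  P ≃br Q = ∃[ R₂ ] ∃[ R₃ ] (IsBrBisim R₂ R₃ × R₂ P Q)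

  _≃br[_]_ : Proc → Subset → Proc → Set₁
  P ≃br[ X ] Q = ∃[ R₂ ] ∃[ R₃ ] (IsBrBisim R₂ R₃ × R₃ P X Q)

  record IsRBrBisim (R₂ : Proc → Proc → Set) (R₃ : Proc → Subset → Proc → Set) : Set₁ where
    field
      sym₂ : ∀ {P Q} → R₂ P Q → R₂ Q P
      sym₃ : ∀ {P X Q} → R₃ P X Q → R₃ Q X P
      c1a : ∀ {P Q α P'} → R₂ P Q → InAτ α → P —[ α ]→ P' →
            ∃[ Q' ] (Q —[ α ]→ Q' × P' ≃br Q')
      c1b : ∀ {P Q} → R₂ P Q → ∀ (Y : Subset) → R₃ P Y Q
      c2a : ∀ {P X Q P'} → R₃ P X Q → P —[ τ ]→ P' →
            ∃[ Q' ] (Q —[ τ ]→ Q' × P' ≃br[ X ] Q')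
      c2b : ∀ {P X Q P'} {a : A} → R₃ P X Q → X a → P —[ vis a ]→ P' →
            ∃[ Q' ] (Q —[ vis a ]→ Q' × P' ≃br Q')
      c2c : ∀ {P X Q} → R₃ P X Q → Idle P X → R₂ P Q
      c2d : ∀ {P X Q P'} → R₃ P X Q → Idle P X → P —[ t ]→ P' →
            ∃[ Q' ] (Q —[ t ]→ Q' × P' ≃br[ X ] Q')

  _≃rbr_ : Proc → Proc → Set₁
  P ≃rbr Q = ∃[ R₂ ] ∃[ R₃ ] (IsRBrBisim R₂ R₃ × R₂ P Q)

  τ-stable : Proc → Set₁
  τ-stable P = ∀ P† → P —[ τ ]→ P† → ¬ (P ≃br P†)

-- A branching bisimulation may answer a step of P either by idling (a τ-step matched by no step)
-- or only after τ-steps Q ⇒ Q₁. Both are ruled out by τ-stability: an idle answer to P —τ→ P'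
-- makes P ≈ P', and a leading step Q —τ→ Q' ⇒ Q₁ with Q ≈ Q₁ makes Q ≈ Q' by stuttering.
-- Answering a time-out of an idle P, a leading τ-step of Q is matched by P standing still,
-- so it is inert too. Thus P and Q match each other's initial steps strictly, which is the
-- root condition; the residuals then only need to be branching bisimilar.
module Submission where

open import Defs
open import Data.Product using (∃-syntax; _×_; _,_; proj₁; map₂)
open import Data.Sum using (_⊎_; inj₁; inj₂)
open import Data.Empty using (⊥-elim)
open import Relation.Nullary using (¬_)
open import Relation.Binary.PropositionalEquality using (_≡_; refl)
open import Relation.Binary.Construct.Closure.ReflexiveTransitive using (ε; _◅_; _◅◅_)

module BranchingBisimilarity (L : LTS) where
  open LTS L
  open IsBrBisim

  Rel₂ : Set₁
  Rel₂ = Proc → Proc → Set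

  Rel₃ : Set₁
  Rel₃ = Proc → Subset L → Proc → Set

  infix 4 _⇒_ _≈_ _≈[_]_

  _⇒_ : Rel₂
  _⇒_ = _⟹_ L

  _≈_ : Proc → Proc → Set₁
  _≈_ = _≃br_ L

  _≈[_]_ : Proc → Subset L → Proc → Set₁
  _≈[_]_ = _≃br[_]_ L

  variable
    α : Act A
    P P' Q Q' Q₁ M U V W : Proc
    X : Subset L
    R₂ : Rel₂
    R₃ : Rel₃

  ⇒-from-τ-free : NoTau L P → P ⇒ P' → P ≡ P'
  ⇒-from-τ-free noτ ε = refl
  ⇒-from-τ-free noτ (step ◅ _) = ⊥-elim (noτ (_ , step))

  optional-τ⇒ : _—⟨_⟩→_ L P τ P' → P ⇒ P'
  optional-τ⇒ (inj₁ (_ , refl)) = ε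
  optional-τ⇒ (inj₂ step) = step ◅ ε

  ≈-sym : P ≈ Q → Q ≈ P
  ≈-sym (R₂ , R₃ , b , r) = R₂ , R₃ , b , sym₂ b r

  ≈⇒≈[_] : ∀ X → P ≈ Q → P ≈[ X ] Q
  ≈⇒≈[ X ] (R₂ , R₃ , b , r) = R₂ , R₃ , b , c1b b r X

  _⨾₂_ : Rel₂ → Rel₂ → Rel₂
  (R ⨾₂ S) P Q = ∃[ M ] (R P M × S M Q)

  _⨾₃_ : Rel₃ → Rel₃ → Rel₃
  (R ⨾₃ S) P X Q = ∃[ M ] (R P X M × S M X Q)

  module Composition (b : IsBrBisim L R₂ R₃) where

    simulate-⇒ : R₂ P Q → P ⇒ P' → ∃[ Q' ] (Q ⇒ Q' × R₂ P' Q')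
    simulate-⇒ r ε = _ , ε , r
    simulate-⇒ r (step ◅ steps) with c1a b r (λ ()) step
    ... | _ , _ , Q⇒Q₁ , Q₁→Q₂ , _ , r₂ with simulate-⇒ r₂ steps
    ... | Q' , Q₂⇒Q' , r' = Q' , Q⇒Q₁ ◅◅ optional-τ⇒ Q₁→Q₂ ◅◅ Q₂⇒Q' , r'

    simulate-⇒[] : R₃ P X Q → P ⇒ P' → ∃[ Q' ] (Q ⇒ Q' × R₃ P' X Q')
    simulate-⇒[] r ε = _ , ε , r
    simulate-⇒[] r (step ◅ steps) with c2a b r step
    ... | _ , _ , Q⇒Q₁ , Q₁→Q₂ , _ , r₂ with simulate-⇒[] r₂ steps
    ... | Q' , Q₂⇒Q' , r' = Q' , Q⇒Q₁ ◅◅ optional-τ⇒ Q₁→Q₂ ◅◅ Q₂⇒Q' , r'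

    simulate-⇒-into-τ-free : R₃ P X Q → NoTau L Q → P ⇒ P' → R₃ P' X Q
    simulate-⇒-into-τ-free r noτ steps with simulate-⇒[] r steps
    ... | _ , Q⇒Q' , r' with ⇒-from-τ-free noτ Q⇒Q'
    ... | refl = r'

    idle-transfer : R₃ P X Q → Idle L P X → NoTau L Q → Idle L Q X
    idle-transfer {X = X} {Q = Q} r (P-noτ , P-refuses) Q-noτ = Q-noτ , Q-refuses
      where
        Q-refuses : ∀ a → X a → ¬ (∃[ Q' ] (Q —[ vis a ]→ Q'))
        Q-refuses a a∈X (_ , step) with c2b b (sym₃ b r) a∈X step
        ... | _ , _ , P⇒P₁ , P₁→P₂ , _ with ⇒-from-τ-free P-noτ P⇒P₁
        ... | refl = P-refuses a a∈X (_ , P₁→P₂)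

    idle-related-τ-free : R₃ P X Q → Idle L P X → NoTau L Q → R₂ P Q
    idle-related-τ-free r idle Q-noτ with c2c b r idle
    ... | _ , Q⇒Q₀ , r₀ with ⇒-from-τ-free Q-noτ Q⇒Q₀
    ... | refl = r₀

    -- The composite needs this for clauses 2(c) and 2(d), which demand an idle middle process.
    idle-match : R₃ P X Q → Idle L P X → ∃[ Q' ] (Q ⇒ Q' × Idle L Q' X × R₂ P Q')
    idle-match {X = X} r idle@(P-noτ , _) with c2c b r idle
    ... | _ , Q⇒Q₀ , r₀ with c2e b (c1b b r₀ X) P-noτ
    ... | Q₁ , Q₀⇒Q₁ , Q₁-noτ =
      Q₁ , Q⇒Q₀ ◅◅ Q₀⇒Q₁ , idle-transfer r₁ idle Q₁-noτ , idle-related-τ-free r₁ idle Q₁-noτ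
      where
        r₁ : R₃ _ X Q₁
        r₁ = sym₃ b (simulate-⇒-into-τ-free (sym₃ b (c1b b r₀ X)) P-noτ Q₀⇒Q₁)

    isBrBisim-⨾ : IsBrBisim L (R₂ ⨾₂ R₂) (R₃ ⨾₃ R₃)
    isBrBisim-⨾ .sym₂ (M , r , s) = M , sym₂ b s , sym₂ b r
    isBrBisim-⨾ .sym₃ (M , r , s) = M , sym₃ b s , sym₃ b r
    isBrBisim-⨾ .c1b (M , r , s) Y = M , c1b b r Y , c1b b s Y
    isBrBisim-⨾ .c1a (M , r , s) α≢t step with c1a b r α≢t step
    ... | M₁ , M₂ , M⇒M₁ , M₁→M₂ , r₁ , r₂ with simulate-⇒ s M⇒M₁ | M₁→M₂
    ... | Q' , Q⇒Q' , s' | inj₁ (refl , refl) =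
      Q' , Q' , Q⇒Q' , inj₁ (refl , refl) , (M₁ , r₁ , s') , (M₁ , r₂ , s')
    ... | Q' , Q⇒Q' , s' | inj₂ M₁→M₂′ with c1a b s' α≢t M₁→M₂′
    ... | Q₁ , Q₂ , Q'⇒Q₁ , Q₁→Q₂ , s₁ , s₂ =
      Q₁ , Q₂ , Q⇒Q' ◅◅ Q'⇒Q₁ , Q₁→Q₂ , (M₁ , r₁ , s₁) , (M₂ , r₂ , s₂)
    isBrBisim-⨾ .c2a (M , r , s) step with c2a b r step
    ... | M₁ , M₂ , M⇒M₁ , M₁→M₂ , r₁ , r₂ with simulate-⇒[] s M⇒M₁ | M₁→M₂
    ... | Q' , Q⇒Q' , s' | inj₁ (_ , refl) =
      Q' , Q' , Q⇒Q' , inj₁ (refl , refl) , (M₁ , r₁ , s') , (M₁ , r₂ , s')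
    ... | Q' , Q⇒Q' , s' | inj₂ M₁→M₂′ with c2a b s' M₁→M₂′
    ... | Q₁ , Q₂ , Q'⇒Q₁ , Q₁→Q₂ , s₁ , s₂ =
      Q₁ , Q₂ , Q⇒Q' ◅◅ Q'⇒Q₁ , Q₁→Q₂ , (M₁ , r₁ , s₁) , (M₂ , r₂ , s₂)
    isBrBisim-⨾ .c2b (M , r , s) a∈X step with c2b b r a∈X step
    ... | M₁ , M₂ , M⇒M₁ , M₁→M₂ , r₁ , r₂ with simulate-⇒[] s M⇒M₁
    ... | Q' , Q⇒Q' , s' with c2b b s' a∈X M₁→M₂
    ... | Q₁ , Q₂ , Q'⇒Q₁ , Q₁→Q₂ , s₁ , s₂ =
      Q₁ , Q₂ , Q⇒Q' ◅◅ Q'⇒Q₁ , Q₁→Q₂ , (M₁ , r₁ , s₁) , (M₂ , r₂ , s₂)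
    isBrBisim-⨾ .c2c (M , r , s) idle with idle-match r idle
    ... | M' , M⇒M' , M'-idle , r' with simulate-⇒[] s M⇒M'
    ... | Q' , Q⇒Q' , s' with c2c b s' M'-idle
    ... | Q₀ , Q'⇒Q₀ , s₀ = Q₀ , Q⇒Q' ◅◅ Q'⇒Q₀ , (M' , r' , s₀)
    isBrBisim-⨾ .c2d {X = X} (M , r , s) idle step with idle-match r idle
    ... | M' , M⇒M' , M'-idle@(M'-noτ , _) , r' with c2d b (c1b b r' X) idle step
    ... | _ , M₂ , M'⇒M₁ , M₁→M₂ , r₂ with ⇒-from-τ-free M'-noτ M'⇒M₁ | simulate-⇒[] s M⇒M'
    ... | refl | Q' , Q⇒Q' , s' with c2d b s' M'-idle M₁→M₂
    ... | Q₁ , Q₂ , Q'⇒Q₁ , Q₁→Q₂ , s₂ = Q₁ , Q₂ , Q⇒Q' ◅◅ Q'⇒Q₁ , Q₁→Q₂ , (M₂ , r₂ , s₂)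
    isBrBisim-⨾ .c2e (M , r , s) P-noτ with c2e b r P-noτ
    ... | M₀ , M⇒M₀ , M₀-noτ with simulate-⇒[] s M⇒M₀
    ... | Q' , Q⇒Q' , s' with c2e b s' M₀-noτ
    ... | Q₀ , Q'⇒Q₀ , Q₀-noτ = Q₀ , Q⇒Q' ◅◅ Q'⇒Q₀ , Q₀-noτ

  ≈-through : IsBrBisim L R₂ R₃ → R₂ P M → R₂ M Q → P ≈ Q
  ≈-through {M = M} b r s = _ , _ , Composition.isBrBisim-⨾ b , (M , r , s)

  module Stuttering (b : IsBrBisim L R₂ R₃) (Q≈Q₁ : R₂ Q Q₁) where

    Between : Proc → Set
    Between W = Q ⇒ W × W ⇒ Q₁

    data Closure (R : Rel₂) : Rel₂ where
      related   : R V W → Closure R V W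
      identical : Closure R V V
      betweenˡ  : Between W → Closure R Q W
      betweenʳ  : Between V → Closure R V Q

    Closure₃ : Rel₃
    Closure₃ V X W = Closure (λ V′ W′ → R₃ V′ X W′) V W

    closure-sym : {R : Rel₂} → (∀ {V W} → R V W → R W V) → Closure R V W → Closure R W V
    closure-sym sym (related r) = related (sym r)
    closure-sym sym identical = identical
    closure-sym sym (betweenˡ w) = betweenʳ w
    closure-sym sym (betweenʳ v) = betweenˡ v

    closure-map : {R S : Rel₂} → (∀ {V W} → R V W → S V W) → Closure R V W → Closure S V W
    closure-map f (related r) = related (f r)
    closure-map f identical = identical
    closure-map f (betweenˡ w) = betweenˡ w
    closure-map f (betweenʳ v) = betweenʳ v

    isBrBisim-closure : IsBrBisim L (Closure R₂) Closure₃
    isBrBisim-closure .sym₂ = closure-sym (sym₂ b)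
    isBrBisim-closure .sym₃ = closure-sym (sym₃ b)
    isBrBisim-closure .c1b c Y = closure-map (λ r → c1b b r Y) c
    isBrBisim-closure .c1a (related r) α≢t step with c1a b r α≢t step
    ... | Q₁ , Q₂ , p , s , r₁ , r₂ = Q₁ , Q₂ , p , s , related r₁ , related r₂
    isBrBisim-closure .c1a identical _ step = _ , _ , ε , inj₂ step , identical , identical
    isBrBisim-closure .c1a (betweenˡ (_ , W⇒Q₁)) α≢t step with c1a b Q≈Q₁ α≢t step
    ... | Q₂ , Q₃ , p , s , r₁ , r₂ = Q₂ , Q₃ , W⇒Q₁ ◅◅ p , s , related r₁ , related r₂
    isBrBisim-closure .c1a (betweenʳ (Q⇒V , _)) _ step = _ , _ , Q⇒V , inj₂ step , identical , identical
    isBrBisim-closure .c2a (related r) step with c2a b r step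
    ... | Q₁ , Q₂ , p , s , r₁ , r₂ = Q₁ , Q₂ , p , s , related r₁ , related r₂
    isBrBisim-closure .c2a identical step = _ , _ , ε , inj₂ step , identical , identical
    isBrBisim-closure .c2a {X = X} (betweenˡ (_ , W⇒Q₁)) step with c2a b (c1b b Q≈Q₁ X) step
    ... | Q₂ , Q₃ , p , s , r₁ , r₂ = Q₂ , Q₃ , W⇒Q₁ ◅◅ p , s , related r₁ , related r₂
    isBrBisim-closure .c2a (betweenʳ (Q⇒V , _)) step = _ , _ , Q⇒V , inj₂ step , identical , identical
    isBrBisim-closure .c2b (related r) a∈X step with c2b b r a∈X step
    ... | Q₁ , Q₂ , p , s , r₁ , r₂ = Q₁ , Q₂ , p , s , related r₁ , related r₂
    isBrBisim-closure .c2b identical _ step = _ , _ , ε , step , identical , identical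
    isBrBisim-closure .c2b {X = X} (betweenˡ (_ , W⇒Q₁)) a∈X step with c2b b (c1b b Q≈Q₁ X) a∈X step
    ... | Q₂ , Q₃ , p , s , r₁ , r₂ = Q₂ , Q₃ , W⇒Q₁ ◅◅ p , s , related r₁ , related r₂
    isBrBisim-closure .c2b (betweenʳ (Q⇒V , _)) _ step = _ , _ , Q⇒V , step , identical , identical
    isBrBisim-closure .c2c (related r) idle with c2c b r idle
    ... | Q₀ , p , r₀ = Q₀ , p , related r₀
    isBrBisim-closure .c2c identical _ = _ , ε , identical
    isBrBisim-closure .c2c {X = X} (betweenˡ (_ , W⇒Q₁)) idle with c2c b (c1b b Q≈Q₁ X) idle
    ... | Q₀ , p , r₀ = Q₀ , W⇒Q₁ ◅◅ p , related r₀
    isBrBisim-closure .c2c (betweenʳ (Q⇒V , _)) _ = _ , Q⇒V , identical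
    isBrBisim-closure .c2d (related r) idle step with c2d b r idle step
    ... | Q₁ , Q₂ , p , s , r₂ = Q₁ , Q₂ , p , s , related r₂
    isBrBisim-closure .c2d identical _ step = _ , _ , ε , step , identical
    isBrBisim-closure .c2d {X = X} (betweenˡ (_ , W⇒Q₁)) idle step with c2d b (c1b b Q≈Q₁ X) idle step
    ... | Q₂ , Q₃ , p , s , r₂ = Q₂ , Q₃ , W⇒Q₁ ◅◅ p , s , related r₂
    isBrBisim-closure .c2d (betweenʳ (Q⇒V , _)) _ step = _ , _ , Q⇒V , step , identical
    isBrBisim-closure .c2e (related r) noτ = c2e b r noτ
    isBrBisim-closure .c2e identical noτ = _ , ε , noτ
    isBrBisim-closure .c2e {X = X} (betweenˡ (_ , W⇒Q₁)) noτ with c2e b (c1b b Q≈Q₁ X) noτ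
    ... | Q₀ , p , Q₀-noτ = Q₀ , W⇒Q₁ ◅◅ p , Q₀-noτ
    isBrBisim-closure .c2e (betweenʳ (Q⇒V , _)) noτ = _ , Q⇒V , noτ

  ≈-stutter : Q ≈ Q₁ → Q ⇒ U → U ⇒ Q₁ → Q ≈ U
  ≈-stutter (_ , _ , b , r) Q⇒U U⇒Q₁ =
    _ , _ , isBrBisim-closure , betweenˡ (Q⇒U , U⇒Q₁)
    where open Stuttering b r

  τ-step-inert : NoTau L P → P ≈ Q → Q —[ τ ]→ Q' → Q ≈ Q'
  τ-step-inert noτ (_ , _ , b , r) step with c1a b (sym₂ b r) (λ ()) step
  ... | _ , _ , P⇒P₁ , P₁→P₂ , r₁ , r₂ with ⇒-from-τ-free noτ P⇒P₁ | P₁→P₂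
  ... | refl | inj₁ (_ , refl) = ≈-through b r₁ (sym₂ b r₂)
  ... | refl | inj₂ P→P₂ = ⊥-elim (noτ (_ , P→P₂))

  record RootMatching (P Q : Proc) : Set₁ where
    field
      match-action  : InAτ L α → P —[ α ]→ P' → ∃[ Q' ] (Q —[ α ]→ Q' × P' ≈ Q')
      match-timeout : Idle L P X → P —[ t ]→ P' → ∃[ Q' ] (Q —[ t ]→ Q' × P' ≈[ X ] Q')

  open RootMatching

  root-matching : τ-stable L P → τ-stable L Q → P ≈ Q → RootMatching P Q
  root-matching P-stable Q-stable (_ , _ , b , r) .match-action α≢t step
    with c1a b r α≢t step
  ... | _ , Q₂ , ε , inj₂ Q→Q₂ , _ , r₂ = Q₂ , Q→Q₂ , (_ , _ , b , r₂)
  ... | _ , _ , ε , inj₁ (refl , refl) , r₁ , r₂ =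
    ⊥-elim (P-stable _ step (≈-through b r₁ (sym₂ b r₂)))
  ... | _ , _ , τ-step ◅ rest , _ , r₁ , _ =
    ⊥-elim (Q-stable _ τ-step (≈-stutter (≈-through b (sym₂ b r) r₁) (τ-step ◅ ε) rest))
  root-matching _ Q-stable P≈Q@(_ , _ , b , r) .match-timeout {X = X} idle step
    with c2d b (c1b b r X) idle step
  ... | _ , Q₂ , ε , Q→Q₂ , r₂ = Q₂ , Q→Q₂ , (_ , _ , b , r₂)
  ... | _ , _ , τ-step ◅ _ , _ , _ =
    ⊥-elim (Q-stable _ τ-step (τ-step-inert (proj₁ idle) P≈Q τ-step))

  ≃rbr-from-root-matching : RootMatching P Q → RootMatching Q P → _≃rbr_ L P Q
  ≃rbr-from-root-matching {P = P} {Q = Q} P→Q Q→P =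
    Root , (λ U _ V → Root U V) , isRBrBisim , inj₁ (refl , refl)
    where
      Root : Rel₂
      Root U V = (U ≡ P × V ≡ Q) ⊎ (U ≡ Q × V ≡ P)

      root-sym : Root U V → Root V U
      root-sym (inj₁ (refl , refl)) = inj₂ (refl , refl)
      root-sym (inj₂ (refl , refl)) = inj₁ (refl , refl)

      matching : Root U V → RootMatching U V
      matching (inj₁ (refl , refl)) = P→Q
      matching (inj₂ (refl , refl)) = Q→P

      isRBrBisim : IsRBrBisim L Root (λ U _ V → Root U V)
      isRBrBisim = record
        { sym₂ = root-sym
        ; sym₃ = root-sym
        ; c1a = λ root → match-action (matching root)
        ; c1b = λ root _ → root
        ; c2a = λ {_} {X} root step → map₂ (map₂ ≈⇒≈[ X ]) (match-action (matching root) (λ ()) step)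
        ; c2b = λ root _ → match-action (matching root) (λ ())
        ; c2c = λ root _ → root
        ; c2d = λ root → match-timeout (matching root)
        }

lemma47 : (L : LTS) (P Q : LTS.Proc L) →
          τ-stable L P → τ-stable L Q →
          _≃br_ L P Q → _≃rbr_ L P Q
lemma47 L P Q P-stable Q-stable P≈Q =
  ≃rbr-from-root-matching (root-matching P-stable Q-stable P≈Q)
                          (root-matching Q-stable P-stable (≈-sym P≈Q))
  where open BranchingBisimilarity L
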